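{- Let $G$ be a hole-with-hat-free graph. Let $C,D$ be disjoint subsets of $V(G)$, complete to each other, such that $C$ is connected. Let $P$ be a connected subgraph of $G\setminus(C\cup D)$ such that some vertex of $P$ has a neighbour in $C$, and no vertex of $P$ is complete to $C$. Then for every $v\in V(P)$ there exists $u\in V(P)$, mixed on $C$, such that every vertex in $D$ adjacent to $v$ is also adjacent to $u$.
   Context: Graphs are finite and simple. A hole is an induced cycle of length at least four; a hole-with-hat is the subgraph induced by a hole $C$ together with a vertex $v\notin V(C)$ having exactly two neighbours in $V(C)$, these being adjacent; $G$ is hole-with-hat-free if it has no hole-with-hat. $G\setminus X$ is the graph obtained by deleting $X$. Disjoint sets $A,B$ are complete to each other if every vertex of $A$ is adjacent to every vertex of $B$, and anticomplete if there are no edges between them; a single vertex is complete/anticomplete to a set accordingly. $X\subseteq V(G)$ is connected if $G[X]$ is connected. A vertex $v\notin C$ is mixed on $C$ if it is neither complete nor anticomplete to $C$. -}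

module Defs where

open import Data.Nat using (ℕ; suc; _≤_; _∸_)
open import Data.Fin using (Fin; toℕ)
open import Data.Fin.Subset using (Subset; _∈_; _∉_)
open import Data.Bool using (Bool; true)
open import Data.Product using (Σ; _×_; ∃; ∃-syntax)
open import Data.Sum using (_⊎_)
open import Relation.Nullary using (¬_)
open import Relation.Binary.PropositionalEquality using (_≡_; _≢_)
open import Function.Definitions using (Injective)

record Graph : Set where
  field
    n     : ℕ
    E     : Fin n → Fin n → Bool
    sym   : ∀ u v → E u v ≡ E v u
    irrefl : ∀ v → E v v ≢ true

open Graph public

V : Graph → Set
V G = Fin (n G)

Adj : (G : Graph) → V G → V G → Set
Adj G u v = E G u v ≡ true

Consec : {k : ℕ} → Fin k → Fin k → Set
Consec {k} i j =
  (toℕ j ≡ suc (toℕ i)) ⊎ (toℕ i ≡ suc (toℕ j))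
  ⊎ ((toℕ i ≡ k ∸ 1) × (toℕ j ≡ 0)) ⊎ ((toℕ j ≡ k ∸ 1) × (toℕ i ≡ 0))

IsHole : (G : Graph) {k : ℕ} → (Fin k → V G) → Set
IsHole G {k} c =
  (4 ≤ k) × Injective _≡_ _≡_ c
  × (∀ i j → (Adj G (c i) (c j) → Consec i j) × (Consec i j → Adj G (c i) (c j)))

IsHat : (G : Graph) {k : ℕ} → (Fin k → V G) → V G → Set
IsHat G {k} c v =
  (∀ l → c l ≢ v)
  × ∃[ i ] ∃[ j ] (i ≢ j × Consec i j × Adj G v (c i) × Adj G v (c j)
                   × (∀ l → Adj G v (c l) → (l ≡ i) ⊎ (l ≡ j)))

HasHoleWithHat : Graph → Set
HasHoleWithHat G =
  Σ ℕ λ k → Σ (Fin k → V G) λ c → Σ (V G) λ v → IsHole G c × IsHat G c v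

HoleWithHatFree : Graph → Set
HoleWithHatFree G = ¬ HasHoleWithHat G

data Reach (G : Graph) (X : Subset (n G)) : V G → V G → Set where
  here : ∀ {u} → u ∈ X → Reach G X u u
  step : ∀ {u w v} → u ∈ X → Adj G u w → Reach G X w v → Reach G X u v

Connected : (G : Graph) → Subset (n G) → Set
Connected G X = ∀ {u v} → u ∈ X → v ∈ X → Reach G X u v

Disjoint : (G : Graph) → Subset (n G) → Subset (n G) → Set
Disjoint G A B = ∀ {v} → v ∈ A → v ∉ B

CompleteSets : (G : Graph) → Subset (n G) → Subset (n G) → Set
CompleteSets G A B = ∀ {a b} → a ∈ A → b ∈ B → Adj G a b

CompleteTo : (G : Graph) → V G → Subset (n G) → Set
CompleteTo G v A = ∀ {a} → a ∈ A → Adj G v a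

AnticompleteTo : (G : Graph) → V G → Subset (n G) → Set
AnticompleteTo G v A = ∀ {a} → a ∈ A → ¬ Adj G v a

HasNeighbourIn : (G : Graph) → V G → Subset (n G) → Set
HasNeighbourIn G v A = ∃[ a ] (a ∈ A × Adj G v a)

-- v (assumed outside A) is mixed on A
Mixed : (G : Graph) → V G → Subset (n G) → Set
Mixed G v A = ¬ CompleteTo G v A × ¬ AnticompleteTo G v A

module Submission where

-- Walk inside P from v towards a vertex with a neighbour in C and stop at
-- the first such vertex u; u is mixed on C since nothing in P is complete to C.
-- Suppose some d ∈ D is adjacent to v but not to u.  Since u is mixed and C is
-- connected, some edge cc' of C has c ~ u and c' ≁ u.  The walk d, v, …, u contains
-- an induced path d = p₀, p₁, …, pₗ = u (l ≥ 2, as d ≁ u), all of whose vertices after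
-- d lie in P and, except u, have no neighbour in C.  Then c, p₀, …, pₗ is a hole and
-- c' (adjacent to c and d only) is a hat on it, contradicting hole-with-hat-freeness.

open import Defs
open import Data.Fin.Subset using (Subset; _∈_; _∉_)
open import Data.Product using (_×_; ∃-syntax)
open import Relation.Nullary using (¬_)

open import Data.Nat using (ℕ; zero; suc; _≤_; z≤n; s≤s)
open import Data.Nat.Properties using (suc-injective; ≤-trans)
open import Data.Fin using (Fin; toℕ; zero; suc) renaming (_≟_ to _≟ᶠ_)
open import Data.Fin.Properties using (toℕ-injective; ¬∀⟶∃¬; any?)
open import Data.Fin.Subset.Properties using (_∈?_)
open import Data.Bool using (true)
open import Data.Bool.Properties using () renaming (_≟_ to _≟ᵇ_)
open import Data.List using (List; []; _∷_; length; lookup)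
open import Data.List.Membership.Propositional using () renaming (_∈_ to _∈ₗ_)
open import Data.List.Membership.Propositional.Properties using (∈-lookup)
open import Data.List.Relation.Unary.All using (All; []; _∷_) renaming (lookup to All-lookup)
open import Data.List.Relation.Unary.All.Properties using (¬Any⇒All¬)
open import Data.List.Relation.Unary.Any using (Any; here; there) renaming (any? to Any-any?)
open import Data.Product using (_,_; proj₁; proj₂)
open import Data.Sum using (_⊎_; inj₁; inj₂; swap) renaming (map to ⊎-map)
open import Data.Empty using (⊥-elim)
open import Function using (_∘_)
open import Function.Bundles using (_⇔_; mk⇔; Equivalence)
open import Function.Construct.Composition using (_⇔-∘_)
open import Function.Construct.Symmetry using (⇔-sym)
open import Function.Definitions using (Injective)
open import Relation.Nullary using (Dec; yes; no)
open import Relation.Nullary.Decidable using (_×-dec_; _⊎-dec_; _→-dec_)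
import Relation.Binary.PropositionalEquality as ≡
open ≡ using (_≡_; _≢_; refl; cong; subst)

Successive : ℕ → ℕ → Set
Successive m n = n ≡ suc m ⊎ m ≡ suc n

successive-sym : ∀ {m n} → Successive m n ⇔ Successive n m
successive-sym = mk⇔ swap swap

successive-suc : ∀ {m n} → Successive (suc m) (suc n) ⇔ Successive m n
successive-suc = mk⇔ (⊎-map suc-injective suc-injective) (⊎-map (cong suc) (cong suc))

consec-sym : ∀ {k} {i j : Fin k} → Consec i j → Consec j i
consec-sym (inj₁ e) = inj₂ (inj₁ e)
consec-sym (inj₂ (inj₁ e)) = inj₁ e
consec-sym (inj₂ (inj₂ (inj₁ p))) = inj₂ (inj₂ (inj₂ p))
consec-sym (inj₂ (inj₂ (inj₂ p))) = inj₂ (inj₂ (inj₁ p))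

consec-suc : ∀ {L} (i j : Fin L) → Consec {suc L} (suc i) (suc j) ⇔ Successive (toℕ i) (toℕ j)
consec-suc {L} i j = mk⇔ to (⊎-map (cong suc) (inj₁ ∘ cong suc))
  where
  to : Consec {suc L} (suc i) (suc j) → Successive (toℕ i) (toℕ j)
  to (inj₁ e) = inj₁ (suc-injective e)
  to (inj₂ (inj₁ e)) = inj₂ (suc-injective e)
  to (inj₂ (inj₂ (inj₁ (_ , ()))))
  to (inj₂ (inj₂ (inj₂ (_ , ()))))

consec-zero : ∀ {L} (j : Fin L) → Consec {suc L} zero (suc j) ⇔ (toℕ j ≡ 0 ⊎ suc (toℕ j) ≡ L)
consec-zero {L} j = mk⇔ to from
  where
  to : Consec {suc L} zero (suc j) → toℕ j ≡ 0 ⊎ suc (toℕ j) ≡ L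
  to (inj₁ e) = inj₁ (suc-injective e)
  to (inj₂ (inj₁ ()))
  to (inj₂ (inj₂ (inj₁ (_ , ()))))
  to (inj₂ (inj₂ (inj₂ (e , _)))) = inj₂ e
  from : toℕ j ≡ 0 ⊎ suc (toℕ j) ≡ L → Consec {suc L} zero (suc j)
  from (inj₁ e) = inj₁ (cong suc e)
  from (inj₂ e) = inj₂ (inj₂ (inj₂ (e , refl)))

consec-zero-zero : ∀ {L} → 1 ≤ L → ¬ Consec {suc L} zero zero
consec-zero-zero (s≤s _) (inj₁ ())
consec-zero-zero (s≤s _) (inj₂ (inj₁ ()))
consec-zero-zero (s≤s _) (inj₂ (inj₂ (inj₁ (() , _))))
consec-zero-zero (s≤s _) (inj₂ (inj₂ (inj₂ (() , _))))

module _ (G : Graph) where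

  adj-sym : ∀ {a b} → Adj G a b → Adj G b a
  adj-sym {a} {b} ab = ≡.trans (Graph.sym G b a) ab

  adj-sym⇔ : ∀ {a b} → Adj G a b ⇔ Adj G b a
  adj-sym⇔ = mk⇔ adj-sym adj-sym

  adj-irrefl : ∀ {a b} → Adj G a b → a ≢ b
  adj-irrefl ab refl = irrefl G _ ab

  adj? : ∀ a b → Dec (Adj G a b)
  adj? a b = E G a b ≟ᵇ true

  Near : V G → V G → Set
  Near a z = a ≡ z ⊎ Adj G a z

  near? : ∀ a z → Dec (Near a z)
  near? a z = (a ≟ᶠ z) ⊎-dec adj? a z

  hasNeighbour? : (C : Subset (n G)) → ∀ x → Dec (HasNeighbourIn G x C)
  hasNeighbour? C x = any? (λ a → (a ∈? C) ×-dec adj? x a)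

  nonNeighbour : ∀ {C u} → ¬ CompleteTo G u C → ∃[ c ] (c ∈ C × ¬ Adj G u c)
  nonNeighbour {C} {u} notComplete
    with ¬∀⟶∃¬ (n G) (λ x → x ∈ C → Adj G u x) (λ x → (x ∈? C) →-dec adj? u x) (λ all → notComplete (all _))
  ... | x , ¬edge with x ∈? C
  ...   | yes x∈C = x , x∈C , λ ux → ¬edge (λ _ → ux)
  ...   | no x∉C = ⊥-elim (¬edge (λ x∈C → ⊥-elim (x∉C x∈C)))

  crossingEdge : ∀ {C u a b} → Reach G C a b → Adj G a u → ¬ Adj G b u
    → ∃[ c ] ∃[ c' ] (c ∈ C × c' ∈ C × Adj G c c' × Adj G c u × ¬ Adj G c' u)
  crossingEdge (here _) au ¬au = ⊥-elim (¬au au)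
  crossingEdge {u = u} (step {a} {w} a∈C aw r) au ¬bu with adj? w u
  ... | yes wu = crossingEdge r wu ¬bu
  ... | no ¬wu = a , w , a∈C , start r , aw , au , ¬wu
    where
    start : ∀ {S x y} → Reach G S x y → x ∈ S
    start (here x∈S) = x∈S
    start (step x∈S _ _) = x∈S

  mixedEdge : ∀ {C u} → Connected G C → HasNeighbourIn G u C → ¬ CompleteTo G u C
    → ∃[ c ] ∃[ c' ] (c ∈ C × c' ∈ C × Adj G c c' × Adj G c u × ¬ Adj G c' u)
  mixedEdge connC (c₀ , c₀∈C , uc₀) notComplete with nonNeighbour notComplete
  ... | c₁ , c₁∈C , ¬uc₁ = crossingEdge (connC c₀∈C c₁∈C) (adj-sym uc₀) (¬uc₁ ∘ adj-sym)

  data Walk (X : V G → Set) : V G → V G → Set where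
    halt : ∀ {u} → X u → Walk X u u
    hop  : ∀ {u w v} → X u → Adj G u w → Walk X w v → Walk X u v

  fromReach : ∀ {S a b} → Reach G S a b → Walk (_∈ S) a b
  fromReach (here a∈S) = halt a∈S
  fromReach (step a∈S aw r) = hop a∈S aw (fromReach r)

  walkMap : ∀ {X Y : V G → Set} {a b} → (∀ {x} → X x → Y x) → Walk X a b → Walk Y a b
  walkMap f (halt xa) = halt (f xa)
  walkMap f (hop xa aw W) = hop (f xa) aw (walkMap f W)

  walkEnd : ∀ {X a b} → Walk X a b → X b
  walkEnd (halt xb) = xb
  walkEnd (hop _ _ W) = walkEnd W

  firstHit : ∀ {X Q : V G → Set} {a b} → (∀ x → Dec (Q x)) → Walk X a b → Q b
    → ∃[ u ] (Q u × Walk (λ x → X x × (x ≡ u ⊎ ¬ Q x)) a u)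
  firstHit Q? (halt xa) qa = _ , qa , halt (xa , inj₁ refl)
  firstHit Q? (hop {a} xa aw W) qb with Q? a
  ... | yes qa = a , qa , halt (xa , inj₁ refl)
  ... | no ¬qa with firstHit Q? W qb
  ...   | u , qu , W′ = u , qu , hop (xa , inj₂ ¬qa) aw W′

  data InducedPath : V G → V G → List (V G) → Set where
    [_]    : ∀ a → InducedPath a a (a ∷ [])
    extend : ∀ {a y b ys} → Adj G a y → All (λ z → ¬ Near a z) ys
           → InducedPath y b (y ∷ ys) → InducedPath a b (a ∷ y ∷ ys)

  startsWith : ∀ {a b ps} → InducedPath a b ps → ∃[ qs ] (ps ≡ a ∷ qs)
  startsWith [ a ] = [] , refl
  startsWith (extend {ys = ys} _ _ _) = _ ∷ ys , refl

  threeVertices : ∀ {a b ps} → InducedPath a b ps → ¬ Near a b → 3 ≤ length ps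
  threeVertices [ a ] far = ⊥-elim (far (inj₁ refl))
  threeVertices (extend ay _ [ y ]) far = ⊥-elim (far (inj₂ ay))
  threeVertices (extend _ _ (extend _ _ _)) far = s≤s (s≤s (s≤s z≤n))

  -- Prepending a vertex u near some vertex of an induced path: cut the path at the last
  -- vertex near u.  The new vertex list is a sublist of u ∷ ps, so X is preserved.
  attach : ∀ {X : V G → Set} {u y b ps} → X u → All X ps → InducedPath y b ps → Any (Near u) ps
    → ∃[ qs ] (InducedPath u b qs × All X qs)
  attach xu xps [ y ] (here (inj₁ refl)) = _ , [ y ] , xps
  attach xu xps [ y ] (here (inj₂ uy)) = _ , extend uy [] [ y ] , xu ∷ xps
  attach {u = u} xu xps@(_ ∷ xys) p@(extend {y = y} {ys = ys} _ _ rest) near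
    with Any-any? (near? u) (y ∷ ys) | near
  ... | yes nearLater | _ = attach xu xys rest nearLater
  ... | no _ | here (inj₁ refl) = _ , p , xps
  ... | no farLater | here (inj₂ uy) = _ , extend uy (¬Any⇒All¬ (y ∷ ys) farLater) p , xu ∷ xps
  ... | no farLater | there nearLater = ⊥-elim (farLater nearLater)

  inducedPath : ∀ {X a b} → Walk X a b → ∃[ ps ] (InducedPath a b ps × All X ps)
  inducedPath (halt xa) = _ , [ _ ] , xa ∷ []
  inducedPath (hop xa aw W) with inducedPath W
  ... | ps , p , xps with startsWith p
  ...   | _ , refl = attach xa xps p (here (inj₂ aw))

  nearHead : ∀ {a y ys} → All (λ z → ¬ Near a z) ys
    → (j : Fin (length (y ∷ ys))) → Near a (lookup (y ∷ ys) j) → j ≡ zero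
  nearHead far zero _ = refl
  nearHead far (suc j) near = ⊥-elim (All-lookup far (∈-lookup j) near)

  lookup-injective : ∀ {a b ps} → InducedPath a b ps → ∀ i j → lookup ps i ≡ lookup ps j → i ≡ j
  lookup-injective [ a ] zero zero _ = refl
  lookup-injective (extend ay far rest) zero zero _ = refl
  lookup-injective (extend ay far rest) zero (suc j) e with nearHead far j (inj₁ e)
  ... | refl = ⊥-elim (adj-irrefl ay e)
  lookup-injective (extend ay far rest) (suc i) zero e with nearHead far i (inj₁ (≡.sym e))
  ... | refl = ⊥-elim (adj-irrefl ay (≡.sym e))
  lookup-injective (extend ay far rest) (suc i) (suc j) e = cong suc (lookup-injective rest i j e)

  path-adj : ∀ {a b ps} → InducedPath a b ps
    → ∀ i j → Adj G (lookup ps i) (lookup ps j) ⇔ Successive (toℕ i) (toℕ j)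
  path-adj [ a ] zero zero = mk⇔ (λ aa → ⊥-elim (adj-irrefl aa refl)) (λ { (inj₁ ()) ; (inj₂ ()) })
  path-adj (extend _ _ _) zero zero = mk⇔ (λ aa → ⊥-elim (adj-irrefl aa refl)) (λ { (inj₁ ()) ; (inj₂ ()) })
  path-adj {a} (extend {y = y} {ys = ys} ay far _) zero (suc j) = mk⇔ to from
    where
    to : Adj G a (lookup (y ∷ ys) j) → Successive 0 (suc (toℕ j))
    to aj = inj₁ (cong (suc ∘ toℕ) (nearHead far j (inj₂ aj)))
    from : Successive 0 (suc (toℕ j)) → Adj G a (lookup (y ∷ ys) j)
    from (inj₁ e) = subst (λ k → Adj G a (lookup (y ∷ ys) k))
                          (≡.sym (toℕ-injective {j = zero} (suc-injective e))) ay
    from (inj₂ ())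
  path-adj p@(extend _ _ _) (suc i) zero = successive-sym ⇔-∘ (path-adj p zero (suc i) ⇔-∘ adj-sym⇔)
  path-adj (extend _ _ rest) (suc i) (suc j) = ⇔-sym successive-suc ⇔-∘ path-adj rest i j

  lastPosition : ∀ {a b ps} → InducedPath a b ps → ∃[ k ] (suc (toℕ k) ≡ length ps × lookup ps k ≡ b)
  lastPosition [ a ] = zero , refl , refl
  lastPosition (extend _ _ rest) with lastPosition rest
  ... | k , isLast , atB = suc k , cong suc isLast , atB

  atLast : ∀ {a b ps} → InducedPath a b ps → ∀ j → lookup ps j ≡ b ⇔ suc (toℕ j) ≡ length ps
  atLast {b = b} {ps} p j with lastPosition p
  ... | k , isLast , atB = mk⇔ to from
    where
    to : lookup ps j ≡ b → suc (toℕ j) ≡ length ps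
    to e = subst (λ i → suc (toℕ i) ≡ length ps)
                 (≡.sym (lookup-injective p j k (≡.trans e (≡.sym atB)))) isLast
    from : suc (toℕ j) ≡ length ps → lookup ps j ≡ b
    from e = subst (λ i → lookup ps i ≡ b)
                   (≡.sym (toℕ-injective (suc-injective (≡.trans e (≡.sym isLast))))) atB

  atFirst : ∀ {a b ps} → InducedPath a b ps → ∀ j → lookup ps j ≡ a ⇔ toℕ j ≡ 0
  atFirst p j with startsWith p
  ... | _ , refl = mk⇔ (λ e → cong toℕ (lookup-injective p j zero e))
                       (λ e → cong (lookup _) (toℕ-injective {j = zero} e))

  ends-adj : ∀ {a b c ps} → InducedPath a b ps → Adj G c a → Adj G c b
    → (∀ {z} → z ∈ₗ ps → Adj G c z → z ≡ a ⊎ z ≡ b)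
    → ∀ j → Adj G c (lookup ps j) ⇔ (toℕ j ≡ 0 ⊎ suc (toℕ j) ≡ length ps)
  ends-adj {c = c} {ps} p ca cb onlyEnds j = mk⇔ to from
    where
    to : Adj G c (lookup ps j) → toℕ j ≡ 0 ⊎ suc (toℕ j) ≡ length ps
    to cj = ⊎-map (Equivalence.to (atFirst p j)) (Equivalence.to (atLast p j)) (onlyEnds (∈-lookup j) cj)
    from : toℕ j ≡ 0 ⊎ suc (toℕ j) ≡ length ps → Adj G c (lookup ps j)
    from (inj₁ e) = subst (Adj G c) (≡.sym (Equivalence.from (atFirst p j) e)) ca
    from (inj₂ e) = subst (Adj G c) (≡.sym (Equivalence.from (atLast p j) e)) cb

  closeHole : ∀ {a b c ps} → InducedPath a b ps → 3 ≤ length ps → (∀ {z} → z ∈ₗ ps → c ≢ z)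
    → Adj G c a → Adj G c b → (∀ {z} → z ∈ₗ ps → Adj G c z → z ≡ a ⊎ z ≡ b)
    → IsHole G (lookup (c ∷ ps))
  closeHole {c = c} {ps} p long cOff ca cb onlyEnds =
    s≤s long , injective , λ i j → Equivalence.to (cycle-adj i j) , Equivalence.from (cycle-adj i j)
    where
    injective : Injective _≡_ _≡_ (lookup (c ∷ ps))
    injective {zero} {zero} _ = refl
    injective {zero} {suc j} e = ⊥-elim (cOff (∈-lookup j) e)
    injective {suc i} {zero} e = ⊥-elim (cOff (∈-lookup i) (≡.sym e))
    injective {suc i} {suc j} e = cong suc (lookup-injective p i j e)
    cycle-adj : ∀ i j → Adj G (lookup (c ∷ ps) i) (lookup (c ∷ ps) j) ⇔ Consec i j
    cycle-adj zero zero =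
      mk⇔ (λ cc → ⊥-elim (adj-irrefl cc refl)) (⊥-elim ∘ consec-zero-zero (≤-trans (s≤s z≤n) long))
    cycle-adj zero (suc j) = ⇔-sym (consec-zero j) ⇔-∘ ends-adj p ca cb onlyEnds j
    cycle-adj (suc i) zero = mk⇔ consec-sym consec-sym ⇔-∘ (cycle-adj zero (suc i) ⇔-∘ adj-sym⇔)
    cycle-adj (suc i) (suc j) = ⇔-sym (consec-suc i j) ⇔-∘ path-adj p i j

  hatOn : ∀ {k} {h : Fin k → V G} {v i j} → IsHole G h → (∀ l → h l ≢ v) → Consec i j
    → Adj G v (h i) → Adj G v (h j) → (∀ l → Adj G v (h l) → h l ≡ h i ⊎ h l ≡ h j)
    → IsHat G h v
  hatOn {h = h} {i = i} {j} (_ , injective , edges) off ij vi vj onlyTwo =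
    off , i , j , i≢j , ij , vi , vj , λ l vl → ⊎-map injective injective (onlyTwo l vl)
    where
    i≢j : i ≢ j
    i≢j refl = adj-irrefl (proj₂ (edges i i) ij) refl

module _ (G : Graph) (C D P : Subset (n G))
  (C∩D : Disjoint G C D) (C—D : CompleteSets G C D) (P∩C : Disjoint G P C) (P∩D : Disjoint G P D) where

  Allowed : V G → V G → V G → Set
  Allowed d u x = x ≡ d ⊎ (x ∈ P × (x ≡ u ⊎ ¬ HasNeighbourIn G x C))

  holeWithHat : ∀ {c c' d u} → c ∈ C → c' ∈ C → d ∈ D → u ∈ P
    → Adj G c c' → Adj G c u → ¬ Adj G c' u → ¬ Adj G d u
    → Walk G (Allowed d u) d u → HasHoleWithHat G
  holeWithHat {c} {c'} {d} {u} c∈C c'∈C d∈D u∈P cc' cu ¬c'u ¬du W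
    with inducedPath G W
  ... | ps , p , allowed with startsWith G p
  ...   | qs , refl =
    _ , lookup (c ∷ ps) , c' , hole ,
    hatOn G {i = zero} {j = suc zero} hole c'Off (inj₁ refl) (adj-sym G cc') (C—D c'∈C d∈D) c'Only
    where
    d≁u : ¬ Near G d u
    d≁u (inj₁ refl) = P∩D u∈P d∈D
    d≁u (inj₂ du) = ¬du du

    notOnPath : ∀ {x z} → x ∈ C → z ∈ₗ ps → x ≢ z
    notOnPath x∈C z∈ps e with All-lookup allowed z∈ps
    ... | inj₁ refl = C∩D x∈C (subst (_∈ D) (≡.sym e) d∈D)
    ... | inj₂ (z∈P , _) = P∩C z∈P (subst (_∈ C) e x∈C)

    seesEnds : ∀ {x z} → x ∈ C → z ∈ₗ ps → Adj G x z → z ≡ d ⊎ z ≡ u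
    seesEnds x∈C z∈ps xz with All-lookup allowed z∈ps
    ... | inj₁ e = inj₁ e
    ... | inj₂ (_ , inj₁ e) = inj₂ e
    ... | inj₂ (_ , inj₂ noNeighbour) = ⊥-elim (noNeighbour (_ , x∈C , adj-sym G xz))

    hole : IsHole G (lookup (c ∷ ps))
    hole = closeHole G p (threeVertices G p d≁u) (notOnPath c∈C) (C—D c∈C d∈D) cu (seesEnds c∈C)

    c'Off : ∀ l → lookup (c ∷ ps) l ≢ c'
    c'Off zero = adj-irrefl G cc'
    c'Off (suc l) e = notOnPath c'∈C (∈-lookup l) (≡.sym e)

    c'Only : ∀ l → Adj G c' (lookup (c ∷ ps) l) → lookup (c ∷ ps) l ≡ c ⊎ lookup (c ∷ ps) l ≡ d
    c'Only zero _ = inj₁ refl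
    c'Only (suc l) c'z with seesEnds c'∈C (∈-lookup l) c'z
    ... | inj₁ e = inj₂ e
    ... | inj₂ e = ⊥-elim (¬c'u (subst (Adj G c') e c'z))

mainTheorem5 : (G : Graph) → HoleWithHatFree G
    → (C D P : Subset (n G))
    → Disjoint G C D → CompleteSets G C D → Connected G C
    → Disjoint G P C → Disjoint G P D → Connected G P
    → (∃[ p ] (p ∈ P × HasNeighbourIn G p C))
    → (∀ {p} → p ∈ P → ¬ CompleteTo G p C)
    → ∀ {v} → v ∈ P
    → ∃[ u ] (u ∈ P × Mixed G u C × (∀ {d} → d ∈ D → Adj G v d → Adj G u d))
mainTheorem5 G hwh C D P C∩D C—D connC P∩C P∩D connP (p , p∈P , pN) notComplete {v} v∈P
  with firstHit G (hasNeighbour? G C) (fromReach G (connP v∈P p∈P)) pN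
... | u , uN@(c₀ , c₀∈C , uc₀) , W = u , u∈P , (notComplete u∈P , λ anti → anti c₀∈C uc₀) , keepsD
  where
  u∈P : u ∈ P
  u∈P = proj₁ (walkEnd G W)

  -- if d ∈ D saw v but not u, the walk d, v, …, u would produce a hole with a hat
  keepsD : ∀ {d} → d ∈ D → Adj G v d → Adj G u d
  keepsD {d} d∈D vd with adj? G u d
  ... | yes ud = ud
  ... | no ¬ud with mixedEdge G connC uN (notComplete u∈P)
  ...   | c , c' , c∈C , c'∈C , cc' , cu , ¬c'u =
    ⊥-elim (hwh (holeWithHat G C D P C∩D C—D P∩C P∩D c∈C c'∈C d∈D u∈P cc' cu ¬c'u
                  (¬ud ∘ adj-sym G) (hop (inj₁ refl) (adj-sym G vd) (walkMap G inj₂ W))))
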